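{- Let $n \ge 1$ and $q \geq 4$ be integers. Then the distance-$2$ chromatic number of the Lee graph $G(n,q)$ satisfies $\chi_2(G(n,q)) \geq 2n+1$ if $-1$ is an adjacency eigenvalue of $G(n,q)$, $\chi_2(G(n,q)) \geq 2n+2$ if $-1$ is not an adjacency eigenvalue of $G(n,q)$, and $\chi_2(G(n,q)) \ge 2n+3$ if $n = 1$ and $q = 5$.
   Context: The Lee graph $G(n,q)$ is the $n$-fold Cartesian product of the cycle $C_q$ with itself; its adjacency eigenvalues are $\sum_{j=1}^n 2\cos(2\pi l_j/q)$ for $l_1,\ldots,l_n\in[1,q]$. $\chi_2(G)$ is the minimum number of colors in a vertex coloring in which any two distinct vertices at distance at most $2$ receive distinct colors. -}

module Defs where

open import Data.Bool using (Bool; true; false; _∧_; _∨_; T)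
open import Data.Nat using (ℕ; zero; suc; _≡ᵇ_; _≤_)
open import Data.Fin using (Fin; toℕ)
open import Data.Fin.Properties using () renaming (_≟_ to _≟ᶠ_)
open import Data.Vec using (Vec; []; _∷_)
open import Data.List using (List; []; _∷_; map; concatMap; allFin; foldr)
open import Data.Product using (Σ; _×_; ∃)
open import Data.Sum using (_⊎_)
open import Data.Rational using (ℚ; 0ℚ; _+_; _*_)
open import Relation.Nullary using (¬_)
open import Relation.Nullary.Decidable using (⌊_⌋)
open import Relation.Binary.PropositionalEquality using (_≡_)

-- Vertices of the Lee graph G(n,q) = C_q □ ... □ C_q (n factors):
-- vectors of length n over Z_q = Fin q.
Vertex : ℕ → ℕ → Set
Vertex n q = Vec (Fin q) n

-- Adjacency in the cycle C_q on vertex set {0,...,q-1}: i ~ j iff j ≡ i ± 1 (mod q).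
cycAdj : (q : ℕ) → Fin q → Fin q → Bool
cycAdj q x y =
  (suc (toℕ x) ≡ᵇ toℕ y) ∨ (suc (toℕ y) ≡ᵇ toℕ x)
  ∨ ((toℕ x ≡ᵇ 0) ∧ (suc (toℕ y) ≡ᵇ q))
  ∨ ((toℕ y ≡ᵇ 0) ∧ (suc (toℕ x) ≡ᵇ q))

eqV : ∀ {n q} → Vertex n q → Vertex n q → Bool
eqV [] [] = true
eqV (x ∷ xs) (y ∷ ys) = ⌊ x ≟ᶠ y ⌋ ∧ eqV xs ys

adjB : ∀ {n q} → Vertex n q → Vertex n q → Bool
adjB {q = q} [] [] = false
adjB {q = q} (x ∷ xs) (y ∷ ys) =
  (cycAdj q x y ∧ eqV xs ys) ∨ (⌊ x ≟ᶠ y ⌋ ∧ adjB xs ys)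

Adj : ∀ {n q} → Vertex n q → Vertex n q → Set
Adj x y = T (adjB x y)

Dist≤2 : ∀ {n q} → Vertex n q → Vertex n q → Set
Dist≤2 {n} {q} x y = x ≡ y ⊎ Adj x y ⊎ Σ (Vertex n q) (λ w → Adj x w × Adj w y)

IsDist2Colouring : (n q c : ℕ) → (Vertex n q → Fin c) → Set
IsDist2Colouring n q c f =
  (x y : Vertex n q) → ¬ (x ≡ y) → Dist≤2 x y → ¬ (f x ≡ f y)

χ₂≥ : (n q k : ℕ) → Set
χ₂≥ n q k = (c : ℕ) (f : Vertex n q → Fin c) → IsDist2Colouring n q c f → k ≤ c

allVertices : (n q : ℕ) → List (Vertex n q)
allVertices zero q = [] ∷ []
allVertices (suc n) q = concatMap (λ a → map (a ∷_) (allVertices n q)) (allFin q)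

sumℚ : List ℚ → ℚ
sumℚ = foldr _+_ 0ℚ

adjEntry : ∀ {n q} → Vertex n q → Vertex n q → ℚ
adjEntry x y with adjB x y
... | true  = Data.Rational.1ℚ
... | false = 0ℚ

adjMul : (n q : ℕ) → (Vertex n q → ℚ) → (Vertex n q → ℚ)
adjMul n q v x = sumℚ (map (λ y → adjEntry x y * v y) (allVertices n q))

IsAdjEigenvalue : (n q : ℕ) → ℚ → Set
IsAdjEigenvalue n q λ' =
  Σ (Vertex n q → ℚ) λ v →
    Σ (Vertex n q) (λ x → ¬ (v x ≡ 0ℚ))
    × ((x : Vertex n q) → adjMul n q v x ≡ λ' * v x)

{-# OPTIONS --safe #-}
module Submission where

-- Every vertex x has 2n neighbours x ± e_i (q ≥ 3), and the closed neighbourhood of x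
-- consists of 2n + 1 vertices pairwise at distance at most 2, so a distance-2 colouring
-- is injective on it. If only 2n + 1 colours are used, every closed neighbourhood sees
-- each colour exactly once: a vertex outside the colour class k has exactly one
-- neighbour in it, a vertex inside has none. For the indicator vector e_k of that class
-- this says A e_k = 1 - e_k, so e_0 - e_1 is an eigenvector of A for the eigenvalue -1.
-- For n = 1 and q = 5, all five vertices of C_5 are pairwise at distance at most 2.

open import Defs
open import Data.Bool using (Bool; true; false; _∧_; _∨_; T; if_then_else_)
open import Data.Bool.ListAction using (any)
open import Data.Bool.Properties using (T-∧; T-∨; ∨-assoc; ∨-comm)
open import Data.Empty using (⊥-elim)
open import Data.Fin using (Fin; zero; suc; toℕ; fromℕ; inject₁; lower₁; splitAt; join; punchOut)
open import Data.Fin.Properties using (_≟_; toℕ-fromℕ; toℕ-inject₁; toℕ-lower₁; join-splitAt; injective⇒≤; punchOut-injective; all?; any?)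
open import Data.List using (List; []; _∷_; map; allFin; concatMap; cartesianProductWith; _++_)
open import Data.List.Properties using (map-cong)
open import Data.List.Membership.Propositional using (_∈_)
open import Data.List.Membership.Propositional.Properties using (∈-cartesianProductWith⁺; ∈-allFin)
open import Data.List.Relation.Unary.All as All using (All; []; _∷_)
open import Data.List.Relation.Unary.AllPairs using ([]; _∷_)
open import Data.List.Relation.Unary.Any using (here; there; satisfied)
open import Data.List.Relation.Unary.Any.Properties using (any⁻)
open import Data.List.Relation.Unary.Unique.Propositional using (Unique)
open import Data.List.Relation.Unary.Unique.Propositional.Properties using (cartesianProductWith⁺; allFin⁺)
open import Data.Nat using (ℕ; zero; suc; _+_; _*_; _≤_; _≡ᵇ_; s≤s; z≤n)
open import Data.Nat.Properties using (≡ᵇ⇒≡; ≡⇒≡ᵇ; 1+n≢n; 1+n≰n; <-asym; ≤-reflexive; m≤n⇒m<n∨m≡n; m≤n⇒m≤1+n) renaming (_≟_ to _≟ℕ_)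
open import Data.Nat.Solver using (module +-*-Solver)
open import Data.Product using (_×_; ∃; _,_; proj₁; proj₂)
open import Data.Rational using (ℚ; 0ℚ; 1ℚ) renaming (-_ to -ℚ_; _+_ to _+ℚ_; _*_ to _*ℚ_; _-_ to _-ℚ_)
open import Data.Rational.Properties using (*-identityˡ; *-zeroˡ)
open import Data.Rational.Solver renaming (module +-*-Solver to ℚ-Solver)
open import Data.Sum using (_⊎_; inj₁; inj₂; [_,_]′)
open import Data.Unit using (tt)
open import Data.Vec using (Vec; []; _∷_; lookup; updateAt; replicate)
open import Data.Vec.Properties using (≡-dec; ∷-injective; ∷-injectiveˡ; lookup∘updateAt; lookup∘updateAt′)
open import Function using (_∘_)
open import Function.Bundles using (Equivalence)
open import Function.Definitions using (Injective)
open import Relation.Nullary using (¬_; yes; no)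
open import Relation.Nullary.Decidable using (⌊_⌋; toWitness; fromWitness; T?)
open import Relation.Binary.PropositionalEquality using (_≡_; _≢_; refl; sym; trans; cong; cong₂; subst; module ≡-Reasoning)

open Equivalence using (to; from)
open ≡-Reasoning

∨-swap-pairs : ∀ a b c d → a ∨ b ∨ c ∨ d ≡ b ∨ a ∨ d ∨ c
∨-swap-pairs a b c d = begin
  a ∨ (b ∨ (c ∨ d))  ≡⟨ ∨-assoc a b (c ∨ d) ⟨
  (a ∨ b) ∨ (c ∨ d)  ≡⟨ cong₂ _∨_ (∨-comm a b) (∨-comm c d) ⟩
  (b ∨ a) ∨ (d ∨ c)  ≡⟨ ∨-assoc b a (d ∨ c) ⟩
  b ∨ (a ∨ (d ∨ c))  ∎

≟-sym : ∀ {q} (a b : Fin q) → ⌊ a ≟ b ⌋ ≡ ⌊ b ≟ a ⌋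
≟-sym a b with a ≟ b | b ≟ a
... | yes _   | yes _   = refl
... | no _    | no _    = refl
... | yes a≡b | no b≢a  = ⊥-elim (b≢a (sym a≡b))
... | no a≢b  | yes b≡a = ⊥-elim (a≢b (sym b≡a))

CycSucc : ℕ → ℕ → ℕ → Set
CycSucc q i j = suc i ≡ j ⊎ (suc i ≡ q × j ≡ 0)

CycSucc-irrefl : ∀ {q i} → 2 ≤ q → ¬ CycSucc q i i
CycSucc-irrefl _ (inj₁ i+1≡i) = 1+n≢n i+1≡i
CycSucc-irrefl (s≤s ()) (inj₂ (refl , refl))

CycSucc-asym : ∀ {q i j} → 3 ≤ q → CycSucc q i j → ¬ CycSucc q j i
CycSucc-asym _ (inj₁ i+1≡j) (inj₁ j+1≡i) = <-asym (≤-reflexive i+1≡j) (≤-reflexive j+1≡i)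
CycSucc-asym (s≤s (s≤s ())) (inj₁ refl) (inj₂ (refl , refl))
CycSucc-asym (s≤s (s≤s ())) (inj₂ (refl , refl)) (inj₁ refl)

module _ {q : ℕ} (a b : Fin q) where
  private
    i = toℕ a
    j = toℕ b

    wraps-around : ∀ k l → T ((l ≡ᵇ 0) ∧ (suc k ≡ᵇ q)) → suc k ≡ q × l ≡ 0
    wraps-around k l w with l≡0 , k+1≡q ← to (T-∧ {l ≡ᵇ 0}) w = ≡ᵇ⇒≡ (suc k) q k+1≡q , ≡ᵇ⇒≡ l 0 l≡0

  cycAdj-sym : cycAdj q a b ≡ cycAdj q b a
  cycAdj-sym = ∨-swap-pairs (suc i ≡ᵇ j) (suc j ≡ᵇ i) ((i ≡ᵇ 0) ∧ (suc j ≡ᵇ q)) ((j ≡ᵇ 0) ∧ (suc i ≡ᵇ q))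

  CycSucc⇒cycAdj : CycSucc q i j → T (cycAdj q a b)
  CycSucc⇒cycAdj (inj₁ i+1≡j) = from T-∨ (inj₁ (≡⇒≡ᵇ _ _ i+1≡j))
  CycSucc⇒cycAdj (inj₂ (i+1≡q , j≡0)) =
    from (T-∨ {suc i ≡ᵇ j}) (inj₂ (from (T-∨ {suc j ≡ᵇ i}) (inj₂
      (from (T-∨ {(i ≡ᵇ 0) ∧ (suc j ≡ᵇ q)}) (inj₂ (from T-∧ (≡⇒≡ᵇ _ _ j≡0 , ≡⇒≡ᵇ _ _ i+1≡q)))))))

  cycAdj⇒CycSucc : T (cycAdj q a b) → CycSucc q i j ⊎ CycSucc q j i
  cycAdj⇒CycSucc t with to (T-∨ {suc i ≡ᵇ j}) t
  ... | inj₁ i+1≡j = inj₁ (inj₁ (≡ᵇ⇒≡ (suc i) j i+1≡j))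
  ... | inj₂ t₁ with to (T-∨ {suc j ≡ᵇ i}) t₁
  ... | inj₁ j+1≡i = inj₂ (inj₁ (≡ᵇ⇒≡ (suc j) i j+1≡i))
  ... | inj₂ t₂ with to (T-∨ {(i ≡ᵇ 0) ∧ (suc j ≡ᵇ q)}) t₂
  ... | inj₁ w = inj₂ (inj₂ (wraps-around j i w))
  ... | inj₂ w = inj₁ (inj₂ (wraps-around i j w))

cycAdj-irrefl : ∀ {q} → 2 ≤ q → (a : Fin q) → ¬ T (cycAdj q a a)
cycAdj-irrefl 2≤q a = [ CycSucc-irrefl 2≤q , CycSucc-irrefl 2≤q ]′ ∘ cycAdj⇒CycSucc a a

module _ {m : ℕ} where

  next : Fin (suc m) → Fin (suc m)
  next a with m ≟ℕ toℕ a
  ... | yes _   = zero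
  ... | no m≢a = suc (lower₁ a m≢a)

  prev : Fin (suc m) → Fin (suc m)
  prev zero    = fromℕ m
  prev (suc b) = inject₁ b

  next-CycSucc : ∀ a → CycSucc (suc m) (toℕ a) (toℕ (next a))
  next-CycSucc a with m ≟ℕ toℕ a
  ... | yes m≡a = inj₂ (cong suc (sym m≡a) , refl)
  ... | no m≢a  = inj₁ (cong suc (sym (toℕ-lower₁ a m≢a)))

  prev-CycSucc : ∀ a → CycSucc (suc m) (toℕ (prev a)) (toℕ a)
  prev-CycSucc zero    = inj₂ (cong suc (toℕ-fromℕ m) , refl)
  prev-CycSucc (suc b) = inj₁ (cong suc (toℕ-inject₁ b))

  cycAdj-next : ∀ a → T (cycAdj (suc m) a (next a))
  cycAdj-next a = CycSucc⇒cycAdj a (next a) (next-CycSucc a)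

  cycAdj-prev : ∀ a → T (cycAdj (suc m) a (prev a))
  cycAdj-prev a = subst T (cycAdj-sym (prev a) a) (CycSucc⇒cycAdj (prev a) a (prev-CycSucc a))

  next≢prev : 2 ≤ m → ∀ a → next a ≢ prev a
  next≢prev 2≤m a next≡prev = CycSucc-asym (s≤s 2≤m) (next-CycSucc a)
    (subst (λ b → CycSucc (suc m) (toℕ b) (toℕ a)) (sym next≡prev) (prev-CycSucc a))

eqV-refl : ∀ {n q} (x : Vertex n q) → T (eqV x x)
eqV-refl []      = tt
eqV-refl (a ∷ x) = from T-∧ (fromWitness {a? = a ≟ a} refl , eqV-refl x)

eqV-sym : ∀ {n q} (x y : Vertex n q) → eqV x y ≡ eqV y x
eqV-sym []      []      = refl
eqV-sym (a ∷ x) (b ∷ y) = cong₂ _∧_ (≟-sym a b) (eqV-sym x y)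

adjB-sym : ∀ {n q} (x y : Vertex n q) → adjB x y ≡ adjB y x
adjB-sym []      []      = refl
adjB-sym (a ∷ x) (b ∷ y) =
  cong₂ _∨_ (cong₂ _∧_ (cycAdj-sym a b) (eqV-sym x y)) (cong₂ _∧_ (≟-sym a b) (adjB-sym x y))

Adj-sym : ∀ {n q} (x y : Vertex n q) → Adj x y → Adj y x
Adj-sym x y = subst T (adjB-sym x y)

Adj-irrefl : ∀ {n q} → 2 ≤ q → (x : Vertex n q) → ¬ Adj x x
Adj-irrefl {q = q} 2≤q (a ∷ x) t with to (T-∨ {cycAdj q a a ∧ eqV x x}) t
... | inj₁ t₁ = cycAdj-irrefl 2≤q a (proj₁ (to T-∧ t₁))
... | inj₂ t₂ = Adj-irrefl 2≤q x (proj₂ (to (T-∧ {⌊ a ≟ a ⌋}) t₂))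

Adj⇒≢ : ∀ {n q} → 2 ≤ q → {x y : Vertex n q} → Adj x y → x ≢ y
Adj⇒≢ 2≤q {x} x~x refl = Adj-irrefl 2≤q x x~x

Adj-updateAt : ∀ {n q} {g : Fin q → Fin q} → (∀ a → T (cycAdj q a (g a))) →
               (x : Vertex n q) (i : Fin n) → Adj x (updateAt x i g)
Adj-updateAt a~ga (a ∷ x) zero    = from T-∨ (inj₁ (from T-∧ (a~ga a , eqV-refl x)))
Adj-updateAt {q = q} a~ga (a ∷ x) (suc i) =
  from (T-∨ {cycAdj q a a ∧ eqV x (updateAt x i _)})
       (inj₂ (from T-∧ (fromWitness {a? = a ≟ a} refl , Adj-updateAt a~ga x i)))

IsDist≤2Clique : ∀ {n q k} → (Fin k → Vertex n q) → Set
IsDist≤2Clique g = Injective _≡_ _≡_ g × (∀ i j → Dist≤2 (g i) (g j))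

module _ {n q c : ℕ} {f : Vertex n q → Fin c} (f-col : IsDist2Colouring n q c f) where

  colouring-injective-on-clique : ∀ {k} {g : Fin k → Vertex n q} → IsDist≤2Clique g → Injective _≡_ _≡_ (f ∘ g)
  colouring-injective-on-clique {g = g} (g-inj , g-close) {i} {j} fgi≡fgj with i ≟ j
  ... | yes i≡j = i≡j
  ... | no i≢j  = ⊥-elim (f-col (g i) (g j) (i≢j ∘ g-inj) (g-close i j) fgi≡fgj)

  Adj⇒colour≢ : 2 ≤ q → {x y : Vertex n q} → Adj x y → f x ≢ f y
  Adj⇒colour≢ 2≤q x~y = f-col _ _ (Adj⇒≢ 2≤q x~y) (inj₂ (inj₁ x~y))

  common-neighbour-colour-injective : ∀ x {y z : Vertex n q} → Adj x y → Adj x z → f y ≡ f z → y ≡ z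
  common-neighbour-colour-injective x {y} {z} x~y x~z fy≡fz with ≡-dec _≟_ y z
  ... | yes y≡z = y≡z
  ... | no y≢z  = ⊥-elim (f-col y z y≢z (inj₂ (inj₂ (x , Adj-sym x y x~y , x~z))) fy≡fz)

χ₂≥-clique : ∀ {n q k} {g : Fin k → Vertex n q} → IsDist≤2Clique g → χ₂≥ n q k
χ₂≥-clique g-clique c f f-col = injective⇒≤ (colouring-injective-on-clique f-col g-clique)

χ₂≥-suc : ∀ {n q k} → χ₂≥ n q k → (∀ f → ¬ IsDist2Colouring n q k f) → χ₂≥ n q (suc k)
χ₂≥-suc χ₂≥k no-colouring c f f-col with m≤n⇒m<n∨m≡n (χ₂≥k c f f-col)
... | inj₁ k<c = k<c
... | inj₂ refl = ⊥-elim (no-colouring f f-col)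

module _ {A : Set} {n : ℕ} {g h : A → A} (xs : Vec A n) where

  updateAt-index-injective : (∀ a → g a ≢ a) → ∀ {i j} → updateAt xs i g ≡ updateAt xs j h → i ≡ j
  updateAt-index-injective g-moves {i} {j} eq with i ≟ j
  ... | yes i≡j = i≡j
  ... | no i≢j  = ⊥-elim (g-moves (lookup xs i) (begin
    g (lookup xs i)             ≡⟨ lookup∘updateAt i xs ⟨
    lookup (updateAt xs i g) i  ≡⟨ cong (λ ys → lookup ys i) eq ⟩
    lookup (updateAt xs j h) i  ≡⟨ lookup∘updateAt′ i j i≢j xs ⟩
    lookup xs i                 ∎))

  updateAt-same-index : ∀ i → updateAt xs i g ≡ updateAt xs i h → g (lookup xs i) ≡ h (lookup xs i)
  updateAt-same-index i eq = begin
    g (lookup xs i)             ≡⟨ lookup∘updateAt i xs ⟨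
    lookup (updateAt xs i g) i  ≡⟨ cong (λ ys → lookup ys i) eq ⟩
    lookup (updateAt xs i h) i  ≡⟨ lookup∘updateAt i xs ⟩
    h (lookup xs i)             ∎

splitAt-injective : ∀ m {n} → Injective _≡_ _≡_ (splitAt m {n})
splitAt-injective m {n} {k} {l} eq = begin
  k                        ≡⟨ join-splitAt m n k ⟨
  join m n (splitAt m k)   ≡⟨ cong (join m n) eq ⟩
  join m n (splitAt m l)   ≡⟨ join-splitAt m n l ⟩
  l                        ∎

neighbour : ∀ {n m} → Vertex n (suc m) → Fin n ⊎ Fin n → Vertex n (suc m)
neighbour x (inj₁ i) = updateAt x i next
neighbour x (inj₂ i) = updateAt x i prev

Adj-neighbour : ∀ {n m} (x : Vertex n (suc m)) u → Adj x (neighbour x u)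
Adj-neighbour x (inj₁ i) = Adj-updateAt cycAdj-next x i
Adj-neighbour x (inj₂ i) = Adj-updateAt cycAdj-prev x i

closedNbhd : ∀ {n m} → Vertex n (suc m) → Fin (suc (n + n)) → Vertex n (suc m)
closedNbhd x zero        = x
closedNbhd {n} x (suc k) = neighbour x (splitAt n k)

closedNbhd-dist≤2 : ∀ {n m} (x : Vertex n (suc m)) k l → Dist≤2 (closedNbhd x k) (closedNbhd x l)
closedNbhd-dist≤2     x zero    zero    = inj₁ refl
closedNbhd-dist≤2 {n} x zero    (suc l) = inj₂ (inj₁ (Adj-neighbour x (splitAt n l)))
closedNbhd-dist≤2 {n} x (suc k) zero    = inj₂ (inj₁ (Adj-sym x _ (Adj-neighbour x (splitAt n k))))
closedNbhd-dist≤2 {n} x (suc k) (suc l) =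
  inj₂ (inj₂ (x , Adj-sym x _ (Adj-neighbour x (splitAt n k)) , Adj-neighbour x (splitAt n l)))

module _ {m : ℕ} (2≤m : 2 ≤ m) where

  private
    2≤q : 2 ≤ suc m
    2≤q = m≤n⇒m≤1+n 2≤m

  next-moves : ∀ a → next a ≢ a
  next-moves a next≡a = CycSucc-irrefl 2≤q (subst (CycSucc (suc m) (toℕ a) ∘ toℕ) next≡a (next-CycSucc a))

  prev-moves : ∀ a → prev a ≢ a
  prev-moves a prev≡a = CycSucc-irrefl 2≤q (subst (λ b → CycSucc (suc m) (toℕ b) (toℕ a)) prev≡a (prev-CycSucc a))

  neighbour-injective : ∀ {n} (x : Vertex n (suc m)) → Injective _≡_ _≡_ (neighbour x)
  neighbour-injective x {inj₁ i} {inj₁ j} eq = cong inj₁ (updateAt-index-injective x next-moves eq)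
  neighbour-injective x {inj₂ i} {inj₂ j} eq = cong inj₂ (updateAt-index-injective x prev-moves eq)
  neighbour-injective x {inj₁ i} {inj₂ j} eq with refl ← updateAt-index-injective x next-moves eq =
    ⊥-elim (next≢prev 2≤m (lookup x i) (updateAt-same-index x i eq))
  neighbour-injective x {inj₂ i} {inj₁ j} eq with refl ← updateAt-index-injective x prev-moves eq =
    ⊥-elim (next≢prev 2≤m (lookup x i) (sym (updateAt-same-index x i eq)))

  closedNbhd-injective : ∀ {n} (x : Vertex n (suc m)) → Injective _≡_ _≡_ (closedNbhd x)
  closedNbhd-injective     x {zero}  {zero}  _  = refl
  closedNbhd-injective {n} x {zero}  {suc l} eq = ⊥-elim (Adj⇒≢ 2≤q (Adj-neighbour x (splitAt n l)) eq)
  closedNbhd-injective {n} x {suc k} {zero}  eq = ⊥-elim (Adj⇒≢ 2≤q (Adj-neighbour x (splitAt n k)) (sym eq))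
  closedNbhd-injective {n} x {suc k} {suc l} eq =
    cong suc (splitAt-injective n (neighbour-injective x eq))

  closedNbhd-isClique : ∀ {n} (x : Vertex n (suc m)) → IsDist≤2Clique (closedNbhd x)
  closedNbhd-isClique x = closedNbhd-injective x , closedNbhd-dist≤2 x

  χ₂≥-closedNbhd : ∀ n → χ₂≥ n (suc m) (suc (n + n))
  χ₂≥-closedNbhd n = χ₂≥-clique (closedNbhd-isClique (replicate n zero))

injective⇒surjective : ∀ {k} {h : Fin k → Fin k} → Injective _≡_ _≡_ h → ∀ j → ∃ λ i → h i ≡ j
injective⇒surjective {suc k} {h} h-inj j with any? (λ i → h i ≟ j)
... | yes hit = hit
... | no miss = ⊥-elim (1+n≰n (injective⇒≤ punched-injective))
  where
  j≢h : ∀ i → j ≢ h i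
  j≢h i j≡hi = miss (i , sym j≡hi)
  punched : Fin (suc k) → Fin k
  punched i = punchOut (j≢h i)
  punched-injective : Injective _≡_ _≡_ punched
  punched-injective {i} {i′} eq = h-inj (punchOut-injective (j≢h i) (j≢h i′) eq)

indicator : Bool → ℚ
indicator b = if b then 1ℚ else 0ℚ

indicator-true : ∀ {b} → T b → indicator b ≡ 1ℚ
indicator-true {true} _ = refl

indicator-false : ∀ {b} → ¬ T b → indicator b ≡ 0ℚ
indicator-false {true}  ¬tt = ⊥-elim (¬tt tt)
indicator-false {false} _   = refl

count : ∀ {A : Set} → (A → Bool) → List A → ℚ
count p xs = sumℚ (map (indicator ∘ p) xs)

module _ {A : Set} {p : A → Bool} where

  count-none : ∀ {xs} → All (λ y → ¬ T (p y)) xs → count p xs ≡ 0ℚ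
  count-none []            = refl
  count-none (¬py ∷ ¬pys) = cong₂ _+ℚ_ (indicator-false ¬py) (count-none ¬pys)

  count-unique : ∀ {xs y} → Unique xs → y ∈ xs → T (p y) → (∀ z → T (p z) → z ≡ y) → count p xs ≡ 1ℚ
  count-unique (y∉ys ∷ _) (here refl) py only-y =
    cong₂ _+ℚ_ (indicator-true py) (count-none (All.map (λ y≢z pz → y≢z (sym (only-y _ pz))) y∉ys))
  count-unique (x∉xs ∷ xs-unique) (there y∈xs) py only-y =
    cong₂ _+ℚ_ (indicator-false (λ px → All.lookup x∉xs y∈xs (only-y _ px)))
               (count-unique xs-unique y∈xs py only-y)

concatMap-cons≡cartesianProductWith : ∀ {A : Set} {n} (as : List A) (vs : List (Vec A n)) →
  concatMap (λ a → map (a ∷_) vs) as ≡ cartesianProductWith _∷_ as vs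
concatMap-cons≡cartesianProductWith []       vs = refl
concatMap-cons≡cartesianProductWith (a ∷ as) vs =
  cong (map (a ∷_) vs ++_) (concatMap-cons≡cartesianProductWith as vs)

allVertices-unique : ∀ n q → Unique (allVertices n q)
allVertices-unique zero    q = [] ∷ []
allVertices-unique (suc n) q =
  subst Unique (sym (concatMap-cons≡cartesianProductWith (allFin q) (allVertices n q)))
    (cartesianProductWith⁺ _∷_ ∷-injective (allFin⁺ q) (allVertices-unique n q))

allVertices-complete : ∀ {n q} (x : Vertex n q) → x ∈ allVertices n q
allVertices-complete []      = here refl
allVertices-complete {suc n} {q} (a ∷ x) =
  subst (a ∷ x ∈_) (sym (concatMap-cons≡cartesianProductWith (allFin q) (allVertices n q)))
    (∈-cartesianProductWith⁺ _∷_ (∈-allFin a) (allVertices-complete x))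

sumℚ-map-sub : ∀ {A : Set} (g h : A → ℚ) xs →
  sumℚ (map (λ y → g y -ℚ h y) xs) ≡ sumℚ (map g xs) -ℚ sumℚ (map h xs)
sumℚ-map-sub g h []       = refl
sumℚ-map-sub g h (y ∷ ys) =
  trans (cong (g y -ℚ h y +ℚ_) (sumℚ-map-sub g h ys)) (sub-+-sub (g y) (h y) _ _)
  where
  open ℚ-Solver
  sub-+-sub : ∀ a b c d → (a -ℚ b) +ℚ (c -ℚ d) ≡ (a +ℚ c) -ℚ (b +ℚ d)
  sub-+-sub = solve 4 (λ a b c d → (a :- b) :+ (c :- d) := (a :+ c) :- (b :+ d)) refl

adjMul-sub : ∀ n q (u w : Vertex n q → ℚ) x →
  adjMul n q (λ y → u y -ℚ w y) x ≡ adjMul n q u x -ℚ adjMul n q w x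
adjMul-sub n q u w x =
  trans (cong sumℚ (map-cong (λ y → *-distribˡ-sub (adjEntry x y) (u y) (w y)) (allVertices n q)))
        (sumℚ-map-sub _ _ (allVertices n q))
  where
  open ℚ-Solver
  *-distribˡ-sub : ∀ a b c → a *ℚ (b -ℚ c) ≡ a *ℚ b -ℚ a *ℚ c
  *-distribˡ-sub = solve 3 (λ a b c → a :* (b :- c) := a :* b :- a :* c) refl

adjEntry-*-indicator : ∀ {n q} (x y : Vertex n q) b → adjEntry x y *ℚ indicator b ≡ indicator (adjB x y ∧ b)
adjEntry-*-indicator x y b with adjB x y
... | true  = *-identityˡ (indicator b)
... | false = *-zeroˡ (indicator b)

adjMul-indicator : ∀ n q (p : Vertex n q → Bool) x →
  adjMul n q (indicator ∘ p) x ≡ count (λ y → adjB x y ∧ p y) (allVertices n q)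
adjMul-indicator n q p x = cong sumℚ (map-cong (λ y → adjEntry-*-indicator x y (p y)) (allVertices n q))

module PerfectColouring {n m : ℕ} (2≤m : 2 ≤ m) (f : Vertex n (suc m) → Fin (suc (n + n)))
                        (f-col : IsDist2Colouring n (suc m) (suc (n + n)) f) where

  colourClass : Fin (suc (n + n)) → Vertex n (suc m) → ℚ
  colourClass k y = indicator ⌊ f y ≟ k ⌋

  closedNbhd-rainbow : ∀ x k → ∃ λ u → f (closedNbhd x u) ≡ k
  closedNbhd-rainbow x = injective⇒surjective (colouring-injective-on-clique f-col (closedNbhd-isClique 2≤m x))

  neighbourOfColour : Fin (suc (n + n)) → Vertex n (suc m) → Vertex n (suc m) → Bool
  neighbourOfColour k x y = adjB x y ∧ ⌊ f y ≟ k ⌋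

  no-neighbour-of-own-colour : ∀ {k} x → f x ≡ k → ∀ y → ¬ T (neighbourOfColour k x y)
  no-neighbour-of-own-colour x fx≡k y t with x~y , fy≡k ← to (T-∧ {adjB x y}) t =
    Adj⇒colour≢ f-col (m≤n⇒m≤1+n 2≤m) x~y (trans fx≡k (sym (toWitness fy≡k)))

  unique-neighbour-of-colour : ∀ {k} x → f x ≢ k →
    ∃ λ y → T (neighbourOfColour k x y) × (∀ z → T (neighbourOfColour k x z) → z ≡ y)
  unique-neighbour-of-colour {k} x fx≢k with closedNbhd-rainbow x k
  ... | zero  , fx≡k = ⊥-elim (fx≢k fx≡k)
  ... | suc l , fy≡k = y , from T-∧ (x~y , fromWitness fy≡k) , only-y
    where
    y : Vertex n (suc m)
    y = neighbour x (splitAt n l)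
    x~y : Adj x y
    x~y = Adj-neighbour x (splitAt n l)
    only-y : ∀ z → T (neighbourOfColour k x z) → z ≡ y
    only-y z t with x~z , fz≡k ← to (T-∧ {adjB x z}) t =
      common-neighbour-colour-injective f-col x x~z x~y (trans (toWitness fz≡k) (sym fy≡k))

  count-neighbours-of-colour : ∀ k x →
    count (neighbourOfColour k x) (allVertices n (suc m)) ≡ 1ℚ -ℚ indicator ⌊ f x ≟ k ⌋
  count-neighbours-of-colour k x with f x ≟ k
  ... | yes fx≡k = count-none (All.universal (no-neighbour-of-own-colour x fx≡k) (allVertices n (suc m)))
  ... | no fx≢k with y , x~y , only-y ← unique-neighbour-of-colour x fx≢k =
    count-unique (allVertices-unique n (suc m)) (allVertices-complete y) x~y only-y

  colourClass-own : ∀ {k y} → f y ≡ k → colourClass k y ≡ 1ℚ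
  colourClass-own {k} {y} fy≡k = indicator-true {⌊ f y ≟ k ⌋} (fromWitness fy≡k)

  colourClass-other : ∀ {k y} → f y ≢ k → colourClass k y ≡ 0ℚ
  colourClass-other {k} {y} fy≢k = indicator-false {⌊ f y ≟ k ⌋} (fy≢k ∘ toWitness)

  adjMul-colourClass : ∀ k x → adjMul n (suc m) (colourClass k) x ≡ 1ℚ -ℚ colourClass k x
  adjMul-colourClass k x =
    trans (adjMul-indicator n (suc m) (λ y → ⌊ f y ≟ k ⌋) x) (count-neighbours-of-colour k x)

  eigenvalue-minus-one : ∀ {k₀ k₁} → k₀ ≢ k₁ → IsAdjEigenvalue n (suc m) (-ℚ 1ℚ)
  eigenvalue-minus-one {k₀} {k₁} k₀≢k₁ = v , (y₀ , v[y₀]≢0) , Av≡-v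
    where
    v : Vertex n (suc m) → ℚ
    v y = colourClass k₀ y -ℚ colourClass k₁ y

    Av≡-v : ∀ x → adjMul n (suc m) v x ≡ -ℚ 1ℚ *ℚ v x
    Av≡-v x = begin
      adjMul n (suc m) v x
        ≡⟨ adjMul-sub n (suc m) (colourClass k₀) (colourClass k₁) x ⟩
      adjMul n (suc m) (colourClass k₀) x -ℚ adjMul n (suc m) (colourClass k₁) x
        ≡⟨ cong₂ _-ℚ_ (adjMul-colourClass k₀ x) (adjMul-colourClass k₁ x) ⟩
      (1ℚ -ℚ colourClass k₀ x) -ℚ (1ℚ -ℚ colourClass k₁ x)
        ≡⟨ difference-of-complements (colourClass k₀ x) (colourClass k₁ x) ⟩
      -ℚ 1ℚ *ℚ v x ∎
      where
      open ℚ-Solver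
      difference-of-complements : ∀ a b → (1ℚ -ℚ a) -ℚ (1ℚ -ℚ b) ≡ -ℚ 1ℚ *ℚ (a -ℚ b)
      difference-of-complements =
        solve 2 (λ a b → (con 1ℚ :- a) :- (con 1ℚ :- b) := con (-ℚ 1ℚ) :* (a :- b)) refl

    y₀ : Vertex n (suc m)
    y₀ = closedNbhd (replicate n zero) (proj₁ (closedNbhd-rainbow (replicate n zero) k₀))

    fy₀≡k₀ : f y₀ ≡ k₀
    fy₀≡k₀ = proj₂ (closedNbhd-rainbow (replicate n zero) k₀)

    v[y₀]≡1 : v y₀ ≡ 1ℚ
    v[y₀]≡1 = cong₂ _-ℚ_ (colourClass-own fy₀≡k₀) (colourClass-other (k₀≢k₁ ∘ trans (sym fy₀≡k₀)))

    v[y₀]≢0 : v y₀ ≢ 0ℚ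
    v[y₀]≢0 v[y₀]≡0 with () ← trans (sym v[y₀]≡1) v[y₀]≡0

within2? : ∀ {n q} → Vertex n q → Vertex n q → Bool
within2? {n} {q} x y = adjB x y ∨ any (λ w → adjB x w ∧ adjB w y) (allVertices n q)

within2?-sound : ∀ {n q} (x y : Vertex n q) → T (within2? x y) → Dist≤2 x y
within2?-sound {n} {q} x y t with to (T-∨ {adjB x y}) t
... | inj₁ x~y = inj₂ (inj₁ x~y)
... | inj₂ path with w , x~w~y ← satisfied (any⁻ (λ w → adjB x w ∧ adjB w y) (allVertices n q) path) =
  inj₂ (inj₂ (w , to (T-∧ {adjB x w}) x~w~y))

C₅ : Fin 5 → Vertex 1 5
C₅ i = i ∷ []

C₅-isClique : IsDist≤2Clique C₅
C₅-isClique = ∷-injectiveˡ , λ i j → within2?-sound (C₅ i) (C₅ j) (pairwise-within2 i j)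
  where
  pairwise-within2 : ∀ i j → T (within2? (C₅ i) (C₅ j))
  pairwise-within2 = toWitness {a? = all? λ i → all? λ j → T? (within2? (C₅ i) (C₅ j))} tt

2n+1≡1+n+n : ∀ n → 2 * n + 1 ≡ suc (n + n)
2n+1≡1+n+n = solve 1 (λ n → con 2 :* n :+ con 1 := con 1 :+ (n :+ n)) refl
  where open +-*-Solver

2n+2≡2+n+n : ∀ n → 2 * n + 2 ≡ suc (suc (n + n))
2n+2≡2+n+n = solve 1 (λ n → con 2 :* n :+ con 2 := con 2 :+ (n :+ n)) refl
  where open +-*-Solver

theorem4p18 : (n q : ℕ) → 1 ≤ n → 4 ≤ q →
    (IsAdjEigenvalue n q (-ℚ 1ℚ) → χ₂≥ n q (2 * n + 1))
    × (¬ IsAdjEigenvalue n q (-ℚ 1ℚ) → χ₂≥ n q (2 * n + 2))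
    × (n ≡ 1 → q ≡ 5 → χ₂≥ n q (2 * n + 3))
theorem4p18 (suc n) (suc (suc (suc (suc r)))) (s≤s z≤n) (s≤s (s≤s (s≤s (s≤s z≤n)))) =
    (λ _ → subst (χ₂≥ _ _) (sym (2n+1≡1+n+n (suc n))) χ₂≥2n+1)
  , (λ no-eigenvalue → subst (χ₂≥ _ _) (sym (2n+2≡2+n+n (suc n)))
       (χ₂≥-suc χ₂≥2n+1 λ f f-col →
         no-eigenvalue (PerfectColouring.eigenvalue-minus-one 2≤m f f-col {zero} {suc zero} λ ())))
  , λ { refl refl → χ₂≥-clique C₅-isClique }
  where
  2≤m : 2 ≤ suc (suc (suc r))
  2≤m = s≤s (s≤s z≤n)
  χ₂≥2n+1 : χ₂≥ (suc n) (4 + r) (suc (suc n + suc n))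
  χ₂≥2n+1 = χ₂≥-closedNbhd 2≤m (suc n)
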